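{- For every positive integer $n$ and every nonnegative integer $m$, \[ \sum_{k=0}^{n-1}k^{\underline{m}}\,\mathbb{F}_{k}=\frac{n^{\underline{m+1}}}{m+1}\,\mathbb{F}_{n}-\sum_{k=0}^{n-1}\frac{(k+1)^{\underline{m+1}}}{m+1}\cdot\frac{1}{F_{k+1}}. \]
   Context: $F_n$ denotes the Fibonacci numbers: $F_0=0$, $F_1=1$, $F_{n+2}=F_{n+1}+F_n$. The $n$-th harmonic Fibonacci number is $\mathbb{F}_{n}=\sum_{k=1}^{n}\frac{1}{F_{k}}$ for $n\ge 1$, with $\mathbb{F}_0=0$ (empty sum). The falling power is $x^{\underline{m}}=x(x-1)\cdots(x-m+1)$, with $x^{\underline{0}}=1$. -}

module Defs where

open import Data.Nat as ℕ using (ℕ; zero; suc; _≤_; z≤n; s≤s; NonZero; >-nonZero)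
open import Data.Nat.Properties using (≤-trans; m≤m+n)
open import Data.Integer using (+_)
open import Data.Rational using (ℚ; 0ℚ; _+_; _/_)

fib : ℕ → ℕ
fib zero = 0
fib (suc zero) = 1
fib (suc (suc n)) = fib (suc n) ℕ.+ fib n

fib-suc-pos : ∀ k → 1 ≤ fib (suc k)
fib-suc-pos zero = s≤s z≤n
fib-suc-pos (suc k) = ≤-trans (fib-suc-pos k) (m≤m+n (fib (suc k)) (fib k))

invFibSuc : ℕ → ℚ
invFibSuc k = (+ 1) / fib (suc k)
  where instance _ : NonZero (fib (suc k))
                 _ = >-nonZero (fib-suc-pos k)

-- harmonic Fibonacci number 𝔽_n = Σ_{k=1}^{n} 1/F_k, 𝔽_0 = 0
harmFib : ℕ → ℚ
harmFib zero = 0ℚ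
harmFib (suc n) = harmFib n + invFibSuc n

fallingPow : ℕ → ℕ → ℕ
fallingPow x zero = 1
fallingPow x (suc m) = x ℕ.* fallingPow (x ℕ.∸ 1) m

sumTo : ℕ → (ℕ → ℚ) → ℚ
sumTo zero f = 0ℚ
sumTo (suc n) f = sumTo n f + f n

{-# OPTIONS --safe #-}
module Submission where

-- Summation by parts. G k = k^{m+1}/(m+1) is a discrete antiderivative of k^m, and 𝔽 is one of
-- 1/F_{k+1}, so Abel's identity Σ_{k<n} ΔG k · 𝔽_k = G n 𝔽_n − G 0 𝔽_0 − Σ_{k<n} G (k+1) · Δ𝔽 k
-- is the theorem once G 0 𝔽_0 = 0 is dropped.

open import Defs
open import Data.Nat as ℕ using (ℕ; zero; suc; NonZero; _∸_; _<_; s≤s)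
import Data.Nat.Properties as ℕ
open import Data.Integer as ℤ using (+_)
import Data.Integer.Properties as ℤ
open import Data.Rational using (ℚ; 0ℚ; _+_; _-_; _*_; _/_; fromℚᵘ)
import Data.Rational.Properties as ℚ
open import Data.Rational.Unnormalised as ℚᵘ using (mkℚᵘ; *≡*)
import Data.Rational.Unnormalised.Properties as ℚᵘ
open import Relation.Binary.PropositionalEquality
open import Relation.Nullary using (yes; no)
open ≡-Reasoning

fallingPow-sucʳ : ∀ n m → fallingPow n (suc m) ≡ fallingPow n m ℕ.* (n ∸ m)
fallingPow-sucʳ n zero = trans (ℕ.*-identityʳ n) (sym (ℕ.*-identityˡ n))
fallingPow-sucʳ n (suc m) = begin
  n ℕ.* fallingPow (n ∸ 1) (suc m)              ≡⟨ cong (n ℕ.*_) (fallingPow-sucʳ (n ∸ 1) m) ⟩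
  n ℕ.* (fallingPow (n ∸ 1) m ℕ.* (n ∸ 1 ∸ m))  ≡⟨ sym (ℕ.*-assoc n _ _) ⟩
  n ℕ.* fallingPow (n ∸ 1) m ℕ.* (n ∸ 1 ∸ m)    ≡⟨ cong (fallingPow n (suc m) ℕ.*_) (ℕ.∸-+-assoc n 1 m) ⟩
  n ℕ.* fallingPow (n ∸ 1) m ℕ.* (n ∸ suc m)    ∎

fallingPow-< : ∀ {n m} → n < m → fallingPow n m ≡ 0
fallingPow-< {zero}  {suc m} _       = refl
fallingPow-< {suc n} {suc m} (s≤s p) = trans (cong (suc n ℕ.*_) (fallingPow-< p)) (ℕ.*-zeroʳ n)

fallingPow-Δ : ∀ n m → fallingPow (suc n) (suc m) ≡ fallingPow n (suc m) ℕ.+ fallingPow n m ℕ.* suc m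
fallingPow-Δ n m with m ℕ.≤? n
... | yes m≤n = begin
  suc n ℕ.* x                       ≡⟨ cong (ℕ._* x) (sym n∸m+1+m≡1+n) ⟩
  (n ∸ m ℕ.+ suc m) ℕ.* x           ≡⟨ ℕ.*-distribʳ-+ x (n ∸ m) (suc m) ⟩
  (n ∸ m) ℕ.* x ℕ.+ suc m ℕ.* x     ≡⟨ cong₂ ℕ._+_ (trans (ℕ.*-comm (n ∸ m) x) (sym (fallingPow-sucʳ n m)))
                                                    (ℕ.*-comm (suc m) x) ⟩
  fallingPow n (suc m) ℕ.+ x ℕ.* suc m ∎
  where
  x = fallingPow n m
  n∸m+1+m≡1+n : n ∸ m ℕ.+ suc m ≡ suc n
  n∸m+1+m≡1+n = trans (ℕ.+-suc (n ∸ m) m) (cong suc (ℕ.m∸n+n≡m m≤n))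
... | no m≰n = begin
  suc n ℕ.* fallingPow n m                          ≡⟨ cong (suc n ℕ.*_) x≡0 ⟩
  suc n ℕ.* 0                                       ≡⟨ ℕ.*-zeroʳ (suc n) ⟩
  0                                                 ≡⟨ sym (cong₂ (λ a b → a ℕ.+ b ℕ.* suc m)
                                                             (fallingPow-< (ℕ.m<n⇒m<1+n n<m)) x≡0) ⟩
  fallingPow n (suc m) ℕ.+ fallingPow n m ℕ.* suc m ∎
  where
  n<m = ℕ.≰⇒> m≰n
  x≡0 = fallingPow-< n<m

fromℚᵘ-homo-+ : ∀ p q → fromℚᵘ (p ℚᵘ.+ q) ≡ fromℚᵘ p + fromℚᵘ q
fromℚᵘ-homo-+ p q = ℚ.toℚᵘ-injective (ℚᵘ.≃-trans (ℚ.toℚᵘ-fromℚᵘ (p ℚᵘ.+ q)) (ℚᵘ.≃-sym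
  (ℚᵘ.≃-trans (ℚ.toℚᵘ-homo-+ (fromℚᵘ p) (fromℚᵘ q))
              (ℚᵘ.+-cong (ℚ.toℚᵘ-fromℚᵘ p) (ℚ.toℚᵘ-fromℚᵘ q)))))

/-split : ∀ a b c d → a ≡ b ℕ.+ c ℕ.* suc d → (+ a) / suc d ≡ (+ b) / suc d + (+ c) / 1
/-split _ b c d refl = trans (ℚ.fromℚᵘ-cong {mkℚᵘ (+ (b ℕ.+ c ℕ.* suc d)) d} {q} (*≡* cross))
                             (fromℚᵘ-homo-+ (mkℚᵘ (+ b) d) (mkℚᵘ (+ c) 0))
  where
  q = mkℚᵘ (+ b) d ℚᵘ.+ mkℚᵘ (+ c) 0
  open import Data.Integer.Solver using (module +-*-Solver)
  open +-*-Solver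
  cross : + (b ℕ.+ c ℕ.* suc d) ℤ.* (+ suc d ℤ.* + 1) ≡ (+ b ℤ.* + 1 ℤ.+ + c ℤ.* + suc d) ℤ.* + suc d
  cross = trans (cong (ℤ._* (+ suc d ℤ.* + 1)) (trans (ℤ.pos-+ b _) (cong (λ z → + b ℤ.+ z) (ℤ.pos-* c (suc d)))))
    (solve 3 (λ b c d → (b :+ c :* d) :* (d :* con (+ 1)) := (b :* con (+ 1) :+ c :* d) :* d)
      refl (+ b) (+ c) (+ suc d))

sumTo-by-parts : (G H a b : ℕ → ℚ) →
  (∀ k → G (suc k) ≡ G k + a k) → (∀ k → H (suc k) ≡ H k + b k) → ∀ n →
  sumTo n (λ k → a k * H k) ≡ G n * H n - G 0 * H 0 - sumTo n (λ k → G (suc k) * b k)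
sumTo-by-parts G H a b ΔG ΔH zero = solve 1 (λ x → con 0ℚ := x :- x :- con 0ℚ) refl (G 0 * H 0)
  where
  open import Data.Rational.Solver using (module +-*-Solver)
  open +-*-Solver
sumTo-by-parts G H a b ΔG ΔH (suc n)
  rewrite sumTo-by-parts G H a b ΔG ΔH n | ΔG n | ΔH n =
  solve 6 (λ g a h i c s → g :* h :- c :- s :+ a :* h := (g :+ a) :* (h :+ i) :- c :- (s :+ (g :+ a) :* i))
    refl (G n) (a n) (H n) (b n) (G 0 * H 0) (sumTo n (λ k → G (suc k) * b k))
  where
  open import Data.Rational.Solver using (module +-*-Solver)
  open +-*-Solver

mainTheorem4 : (n m : ℕ) → .{{_ : NonZero n}} →
    sumTo n (λ k → ((+ fallingPow k m) / 1) * harmFib k)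
      ≡ ((+ fallingPow n (suc m)) / suc m) * harmFib n
        - sumTo n (λ k → ((+ fallingPow (suc k) (suc m)) / suc m) * invFibSuc k)
-- The identity also holds for n = 0.
mainTheorem4 n m = begin
  sumTo n (λ k → a k * harmFib k)                           ≡⟨ sumTo-by-parts G harmFib a invFibSuc ΔG (λ _ → refl) n ⟩
  G n * harmFib n - G 0 * 0ℚ - S                            ≡⟨ cong (λ z → G n * harmFib n - z - S) (ℚ.*-zeroʳ (G 0)) ⟩
  G n * harmFib n - 0ℚ - S                                  ≡⟨ cong (_- S) (ℚ.+-identityʳ (G n * harmFib n)) ⟩
  G n * harmFib n - S                                       ∎
  where
  G a : ℕ → ℚ
  G k = (+ fallingPow k (suc m)) / suc m
  a k = (+ fallingPow k m) / 1
  ΔG : ∀ k → G (suc k) ≡ G k + a k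
  ΔG k = /-split _ (fallingPow k (suc m)) (fallingPow k m) m (fallingPow-Δ k m)
  S = sumTo n (λ k → G (suc k) * invFibSuc k)
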